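{- For $\ell \geq 1$ and $n \geq 2\ell+1$, $$\gamma(P^\ell_n,x) = x\sum_{j=1}^{2\ell+1} \gamma(P^\ell_{n-j},x).$$ For $\ell \geq 1$ and $n \geq 2\ell+2$, $$\gamma(C^\ell_n,x) = x\sum_{j=1}^{2\ell+1} \gamma(C^\ell_{n-j},x).$$
   Context: A dominating set in a graph $G$ is a set $D$ of vertices such that every vertex of $G$ is in $D$ or adjacent to a vertex of $D$. $\gamma_k(G)$ denotes the number of dominating sets of $G$ of size $k$, and the domination polynomial is $\gamma(G,x)=\sum_{k\geq 0}\gamma_k(G)x^k$. For a graph $G$ and positive integer $\ell$, the $\ell$th power of $G$ is the graph on the same vertex set in which two distinct vertices are adjacent iff their distance in $G$ is at most $\ell$. $P^\ell_n$ is the $\ell$th power of the path on $n$ vertices and $C^\ell_n$ is the $\ell$th power of the cycle on $n$ vertices. By convention $P^\ell_0$ and $C^\ell_0$ are the graph with no vertices (so their domination polynomial is $1$), $C^\ell_1$ is a single isolated vertex, and $C^\ell_2$ is the complete graph on two vertices. -}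

module Defs where

open import Data.Nat using (ℕ; zero; suc; _+_; _*_; _∸_; _≤_; _⊓_; ∣_-_∣)
open import Data.Nat.Properties using (_≤?_; _≟_)
open import Data.Fin using (Fin; toℕ)
import Data.Fin.Properties as FinP
open import Data.Fin.Subset using (Subset; _∈_; ∣_∣)
open import Data.Fin.Subset.Properties using (_∈?_)
open import Data.Bool using (true; false)
open import Data.Vec using ([]; _∷_)
open import Data.List using (List; []; _∷_; map; _++_; length; filter; upTo)
open import Data.Nat.ListAction using (sum)
open import Data.Product using (_×_; ∃; _,_)
open import Data.Sum using (_⊎_)
open import Relation.Nullary using (Dec; ¬_)
open import Relation.Nullary.Decidable using (_×-dec_; _⊎-dec_; ¬?)
open import Relation.Binary.PropositionalEquality using (_≡_; _≢_)

record Graph (n : ℕ) : Set₁ where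
  field
    Adj  : Fin n → Fin n → Set
    adj? : ∀ u v → Dec (Adj u v)
open Graph public

Dominating : ∀ {n} → Graph n → Subset n → Set
Dominating G D = ∀ v → v ∈ D ⊎ ∃ λ u → u ∈ D × Adj G u v

dominating? : ∀ {n} (G : Graph n) (D : Subset n) → Dec (Dominating G D)
dominating? G D = FinP.all? λ v → (v ∈? D) ⊎-dec FinP.any? (λ u → (u ∈? D) ×-dec adj? G u v)

allSubsets : (n : ℕ) → List (Subset n)
allSubsets zero = [] ∷ []
allSubsets (suc n) = map (false ∷_) (allSubsets n) ++ map (true ∷_) (allSubsets n)

-- γ_k(G): number of dominating sets of size k.
-- The domination polynomial γ(G,x) is represented by its coefficient sequence k ↦ γ_k(G).
domPoly : ∀ {n} → Graph n → ℕ → ℕ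
domPoly {n} G k = length (filter (λ D → (∣ D ∣ ≟ k) ×-dec dominating? G D) (allSubsets n))

xTimes : (ℕ → ℕ) → ℕ → ℕ
xTimes p zero = 0
xTimes p (suc k) = p k

sumFrom1 : ℕ → (ℕ → ℕ → ℕ) → ℕ → ℕ
sumFrom1 m f k = sum (map (λ i → f (suc i) k) (upTo m))

PathPow : ℕ → (n : ℕ) → Graph n
PathPow ℓ n = record
  { Adj  = λ u v → u ≢ v × ∣ toℕ u - toℕ v ∣ ≤ ℓ
  ; adj? = λ u v → ¬? (u FinP.≟ v) ×-dec (∣ toℕ u - toℕ v ∣ ≤? ℓ) }

-- ℓ-th power of the cycle on n vertices 0,…,n-1 (cycle distance min(d, n-d)).
-- For n = 1 this is an isolated vertex, for n = 2 it is K₂, for n = 0 the empty graph.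
CyclePow : ℕ → (n : ℕ) → Graph n
CyclePow ℓ n = record
  { Adj  = λ u v → u ≢ v × (∣ toℕ u - toℕ v ∣ ⊓ (n ∸ ∣ toℕ u - toℕ v ∣)) ≤ ℓ
  ; adj? = λ u v → ¬? (u FinP.≟ v) ×-dec ((∣ toℕ u - toℕ v ∣ ⊓ (n ∸ ∣ toℕ u - toℕ v ∣)) ≤? ℓ) }

-- Encode a set of vertices 0, …, n−1 by its characteristic bit list. A set dominates the ℓ-th power of
-- the path iff its first member is among the first ℓ+1 vertices, its last among the last ℓ+1, and
-- consecutive members are at most 2ℓ+1 apart; an automaton counting down the admissible gap decides
-- this. Splitting the accepted lists by the position of their first member writes every count as a sum
-- of shifted counts of lists that start with a member, and these satisfy the recurrence (a member, then
-- j−1 non-members, j ≤ 2ℓ+1) up to boundary terms that vanish or cancel once n ≥ 2ℓ+1. For the cycle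
-- power, rotating the leading non-members to the end leaves a list that starts with a member, so the
-- same automaton applies, with the final gap shortened by their number.
module Submission where

open import Defs
import Algebra.Properties.CommutativeMonoid.Sum as ∑
open import Data.Bool using (Bool; true; false; T)
open import Data.Bool.Properties using (T-≡)
open import Data.Empty using (⊥-elim)
open import Data.Fin as Fin using (Fin; toℕ; fromℕ<)
open import Data.Fin.Properties using (toℕ-fromℕ<; toℕ<n; toℕ-inject₁; toℕ-fromℕ)
open import Data.Fin.Subset using (Subset; ∣_∣; _∈_)
open import Data.List using (List; []; _∷_; map; _++_; length; filter; applyUpTo; replicate)
open import Data.List.Properties
  using (filter-++; filter-≐; filter-none; length-++; length-++-sucʳ; length-replicate; ++-identityʳ; ++-assoc)
import Data.List.Relation.Unary.All as All
import Data.Nat.ListAction as ListAction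
open import Data.Nat
  using (ℕ; zero; suc; _+_; _*_; _∸_; _≤_; _<_; _≟_; _≤ᵇ_; _≡ᵇ_; _⊓_; ∣_-_∣; z≤n; s≤s; s≤s⁻¹)
open import Data.Nat.Properties
  using ( +-0-commutativeMonoid; _≤?_; _<?_; ≤ᵇ⇒≤; ≤⇒≤ᵇ; suc-injective
        ; ≤-refl; ≤-reflexive; ≤-trans; ≤-antisym; ≤-total; <-≤-trans; <⇒≤; <⇒≱; <-irrefl; ≮⇒≥; ≰⇒>
        ; +-comm; +-assoc; +-suc; +-identityʳ; +-cancelˡ-≤; +-cancelʳ-≤; +-cancelˡ-<
        ; +-mono-≤; +-monoˡ-≤; +-monoʳ-≤; +-monoˡ-<; +-monoʳ-<; m≤m+n; m≤n+m; n≤1+n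
        ; ∸-+-assoc; +-∸-assoc; 0∸n≡0; m∸n≤m; m∸[m∸n]≡n; m∸n+n≡m; m≤n+m∸n; m≤n+o⇒m∸n≤o; m+n≤o⇒m≤o∸n
        ; m<n⇒0<n∸m; m≤n⇒m∸n≡0; m∸n≡0⇒m≤n; n≤0⇒n≡0
        ; ⊓-comm; ⊓-sel; m≤n⇒m⊓o≤n; m≤n⇒o⊓m≤n
        ; ∣n-n∣≡0; ∣-∣-comm; m≤n+∣m-n∣; m≤n⇒∣m-n∣≡n∸m; m≤n⇒∣n-m∣≡n∸m; ∣m+n-m+o∣≡∣n-o∣)
open import Data.Product using (_×_; _,_; proj₂; map₁; map₂; ∃-syntax)
open import Data.Sum using (_⊎_; inj₁; inj₂)
import Data.Sum as Sum
open import Data.Vec using (toList; lookup) renaming ([] to []ᵥ; _∷_ to _∷ᵥ_)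
open import Data.Vec.Properties using (length-toList; []=⇒lookup; lookup⇒[]=)
open import Function using (_∘_; _⇔_; mk⇔; Equivalence)
import Function.Properties.Equivalence as ⇔
open import Level using (0ℓ)
open import Relation.Binary.PropositionalEquality
open import Relation.Nullary using (¬_; does; yes; no)
open import Relation.Nullary.Decidable using (_×-dec_; T?)
open import Relation.Unary using (Pred; Decidable; _≐_)

open Equivalence using (to; from)
open ∑ +-0-commutativeMonoid
  using (sum-syntax; sum-cong-≗; sum-replicate-zero; sum-init-last; ∑-distrib-+; ∑-comm)

#subsets : ∀ {n} {Q : Pred (Subset n) 0ℓ} → Decidable Q → ℕ → ℕ
#subsets {n} Q? k = length (filter (λ D → (∣ D ∣ ≟ k) ×-dec Q? D) (allSubsets n))

length-filter-map : ∀ {A B : Set} {P : Pred B 0ℓ} (P? : Decidable P) (f : A → B) xs →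
                    length (filter P? (map f xs)) ≡ length (filter (P? ∘ f) xs)
length-filter-map P? f []       = refl
length-filter-map P? f (x ∷ xs) with does (P? (f x))
... | true  = cong suc (length-filter-map P? f xs)
... | false = length-filter-map P? f xs

#subsets-cong : ∀ {n} {Q Q′ : Pred (Subset n) 0ℓ} (Q? : Decidable Q) (Q′? : Decidable Q′) →
                Q ≐ Q′ → ∀ k → #subsets Q? k ≡ #subsets Q′? k
#subsets-cong Q? Q′? (Q⊆Q′ , Q′⊆Q) k =
  cong length (filter-≐ (λ D → (∣ D ∣ ≟ k) ×-dec Q? D) _ (map₂ Q⊆Q′ , map₂ Q′⊆Q) (allSubsets _))

#subsets-none : ∀ {n} {Q : Pred (Subset n) 0ℓ} (Q? : Decidable Q) → (∀ D → ¬ Q D) → ∀ k → #subsets Q? k ≡ 0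
#subsets-none {n} Q? ¬Q k = cong length (filter-none _ (All.universal (λ D → ¬Q D ∘ proj₂) (allSubsets n)))

#subsets-suc : ∀ {n} {Q : Pred (Subset (suc n)) 0ℓ} (Q? : Decidable Q) k →
               #subsets Q? k ≡ #subsets (Q? ∘ (false ∷ᵥ_)) k + xTimes (#subsets (Q? ∘ (true ∷ᵥ_))) k
#subsets-suc {n} {Q} Q? k = begin
  length (filter P? (map (false ∷ᵥ_) S ++ map (true ∷ᵥ_) S))
    ≡⟨ cong length (filter-++ P? (map (false ∷ᵥ_) S) _) ⟩
  length (filter P? (map (false ∷ᵥ_) S) ++ filter P? (map (true ∷ᵥ_) S))
    ≡⟨ length-++ (filter P? (map (false ∷ᵥ_) S)) ⟩
  length (filter P? (map (false ∷ᵥ_) S)) + length (filter P? (map (true ∷ᵥ_) S))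
    ≡⟨ cong₂ _+_ (length-filter-map P? _ S) (length-filter-map P? _ S) ⟩
  #subsets (Q? ∘ (false ∷ᵥ_)) k + length (filter (P? ∘ (true ∷ᵥ_)) S)
    ≡⟨ cong (#subsets (Q? ∘ (false ∷ᵥ_)) k +_) (withMember k) ⟩
  #subsets (Q? ∘ (false ∷ᵥ_)) k + xTimes (#subsets (Q? ∘ (true ∷ᵥ_))) k ∎
  where
  open ≡-Reasoning
  S : List (Subset n)
  S = allSubsets n
  P? : Decidable (λ D → ∣ D ∣ ≡ k × Q D)
  P? D = (∣ D ∣ ≟ k) ×-dec Q? D
  withMember : ∀ k → length (filter (λ D → (suc ∣ D ∣ ≟ k) ×-dec Q? (true ∷ᵥ D)) S)
                     ≡ xTimes (#subsets (Q? ∘ (true ∷ᵥ_))) k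
  withMember zero    = cong length (filter-none _ (All.universal (λ _ → λ ()) S))
  withMember (suc k) = cong length (filter-≐ _ _ (map₁ suc-injective , map₁ (cong suc)) S)

∑-cong : ∀ {s} {f g : Fin s → ℕ} → (∀ i → f i ≡ g i) → ∑[ i < s ] f i ≡ ∑[ i < s ] g i
∑-cong = sum-cong-≗

∑-zero : ∀ s (f : Fin s → ℕ) → (∀ i → f i ≡ 0) → ∑[ i < s ] f i ≡ 0
∑-zero s f f≗0 = trans (∑-cong f≗0) (sum-replicate-zero s)

∑-last : ∀ s (f : ℕ → ℕ) → ∑[ i < suc s ] f (toℕ i) ≡ ∑[ i < s ] f (toℕ i) + f s
∑-last s f = trans (sum-init-last {s} (f ∘ toℕ))
  (cong₂ _+_ (∑-cong {s} {f = f ∘ toℕ ∘ Fin.inject₁} (cong f ∘ toℕ-inject₁)) (cong f (toℕ-fromℕ s)))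

∑-only-last : ∀ s (f : ℕ → ℕ) → (∀ i → i < s → f i ≡ 0) → ∑[ i < suc s ] f (toℕ i) ≡ f s
∑-only-last s f f≡0 = trans (∑-last s f) (cong (_+ f s) (∑-zero s (f ∘ toℕ) (λ i → f≡0 (toℕ i) (toℕ<n i))))

sum-map-applyUpTo : ∀ (g h : ℕ → ℕ) m → ListAction.sum (map g (applyUpTo h m)) ≡ ∑[ i < m ] g (h (toℕ i))
sum-map-applyUpTo g h zero    = refl
sum-map-applyUpTo g h (suc m) = cong (g (h 0) +_) (sum-map-applyUpTo g (h ∘ suc) m)

sumFrom1≡∑ : ∀ m f k → sumFrom1 m f k ≡ ∑[ i < m ] f (suc (toℕ i)) k
sumFrom1≡∑ m f k = sum-map-applyUpTo (λ i → f (suc i) k) (λ i → i) m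

xTimes-cong : ∀ {f g : ℕ → ℕ} → (∀ k → f k ≡ g k) → ∀ k → xTimes f k ≡ xTimes g k
xTimes-cong f≗g zero    = refl
xTimes-cong f≗g (suc k) = f≗g k

≡⇒⇔ : ∀ {A B : Set} → A ≡ B → A ⇔ B
≡⇒⇔ refl = ⇔.refl

≤ᵇ-suc : ∀ a t → (suc a ≤ᵇ suc t) ≡ (a ≤ᵇ t)
≤ᵇ-suc zero    t = refl
≤ᵇ-suc (suc a) t = refl

∸-comm : ∀ m a b → m ∸ a ∸ b ≡ m ∸ b ∸ a
∸-comm m a b = trans (∸-+-assoc m a b) (trans (cong (m ∸_) (+-comm a b)) (sym (∸-+-assoc m b a)))

⊓≤-split : ∀ {a b c} → a ⊓ b ≤ c → a ≤ c ⊎ b ≤ c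
⊓≤-split {a} {b} le with ⊓-sel a b
... | inj₁ eq = inj₁ (subst (_≤ _) eq le)
... | inj₂ eq = inj₂ (subst (_≤ _) eq le)

offsetView : ∀ p v → v < p ⊎ ∃[ i ] v ≡ p + i
offsetView zero    v       = inj₂ (v , refl)
offsetView (suc p) zero    = inj₁ (s≤s z≤n)
offsetView (suc p) (suc v) with offsetView p v
... | inj₁ v<p        = inj₁ (s≤s v<p)
... | inj₂ (i , refl) = inj₂ (i , refl)

_!_ : List Bool → ℕ → Bool
[]      ! _     = false
(b ∷ _) ! zero  = b
(_ ∷ L) ! suc u = L ! u

!-bound : ∀ L {u} → T (L ! u) → u < length L
!-bound (_ ∷ _) {zero}  _ = s≤s z≤n
!-bound (_ ∷ L) {suc u} m = s≤s (!-bound L m)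

replicate-false-! : ∀ a u → ¬ T (replicate a false ! u)
replicate-false-! (suc a) (suc u) m = replicate-false-! a u m

replicate-∷ʳ : ∀ {A : Set} a (x : A) → replicate a x ++ x ∷ [] ≡ replicate (suc a) x
replicate-∷ʳ zero    x = refl
replicate-∷ʳ (suc a) x = cong (x ∷_) (replicate-∷ʳ a x)

toList-! : ∀ {n} (D : Subset n) i → toList D ! toℕ i ≡ lookup D i
toList-! (_ ∷ᵥ _) Fin.zero    = refl
toList-! (_ ∷ᵥ D) (Fin.suc i) = toList-! D i

∈⇔! : ∀ {n} {D : Subset n} {i} → i ∈ D ⇔ T (toList D ! toℕ i)
∈⇔! {D = D} {i} = mk⇔ (λ i∈D → from T-≡ (trans (toList-! D i) ([]=⇒lookup i∈D)))
                      (λ m → lookup⇒[]= i D (trans (sym (toList-! D i)) (to T-≡ m)))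

!⇒∈ : ∀ {n} (D : Subset n) {u} → T (toList D ! u) → ∃[ i ] toℕ i ≡ u × i ∈ D
!⇒∈ {n} D {u} m = fromℕ< u<n , toℕ-fromℕ< u<n , from ∈⇔! (subst (T ∘ (toList D !_)) (sym (toℕ-fromℕ< u<n)) m)
  where
  u<n : u < n
  u<n = subst (u <_) (length-toList D) (!-bound (toList D) m)

cycDist : ℕ → ℕ → ℕ → ℕ
cycDist n u v = ∣ u - v ∣ ⊓ (n ∸ ∣ u - v ∣)

cycDist-refl : ∀ n x → cycDist n x x ≡ 0
cycDist-refl n x = cong (λ d → d ⊓ (n ∸ d)) (∣n-n∣≡0 x)

cycDist-comm : ∀ n u v → cycDist n u v ≡ cycDist n v u
cycDist-comm n u v = cong (λ d → d ⊓ (n ∸ d)) (∣-∣-comm u v)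

cycDist-wrap : ∀ m y → y ≤ m → cycDist (suc m) m y ≡ cycDist (suc m) 0 (suc y)
cycDist-wrap m y y≤m = begin
  ∣ m - y ∣ ⊓ (suc m ∸ ∣ m - y ∣) ≡⟨ cong (λ d → d ⊓ (suc m ∸ d)) (m≤n⇒∣n-m∣≡n∸m y≤m) ⟩
  (m ∸ y) ⊓ (suc m ∸ (m ∸ y))     ≡⟨ cong ((m ∸ y) ⊓_) 1+m∸[m∸y]≡1+y ⟩
  (m ∸ y) ⊓ suc y                 ≡⟨ ⊓-comm (m ∸ y) (suc y) ⟩
  suc y ⊓ (m ∸ y)                 ∎
  where
  open ≡-Reasoning
  1+m∸[m∸y]≡1+y : suc m ∸ (m ∸ y) ≡ suc y
  1+m∸[m∸y]≡1+y = trans (+-∸-assoc 1 (m∸n≤m m y)) (cong suc (m∸[m∸n]≡n y≤m))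

rotIndex : ℕ → ℕ → ℕ
rotIndex m zero    = m
rotIndex m (suc u) = u

rotIndex-< : ∀ m u → u < suc m → rotIndex m u < suc m
rotIndex-< m zero    _          = s≤s ≤-refl
rotIndex-< m (suc u) (s≤s u<m) = ≤-trans u<m (n≤1+n m)

rotIndex-onto : ∀ m v → v < suc m → ∃[ u ] u < suc m × rotIndex m u ≡ v
rotIndex-onto m v v≤m with v <? m
... | yes v<m = suc v , s≤s v<m , refl
... | no  v≮m = 0 , s≤s z≤n , ≤-antisym (≮⇒≥ v≮m) (s≤s⁻¹ v≤m)

rotIndex-lookup : ∀ b L u → u < suc (length L) → (L ++ b ∷ []) ! rotIndex (length L) u ≡ (b ∷ L) ! u
rotIndex-lookup b L zero    _          = last-lookup L
  where
  last-lookup : ∀ L → (L ++ b ∷ []) ! length L ≡ b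
  last-lookup []      = refl
  last-lookup (_ ∷ L) = last-lookup L
rotIndex-lookup b L (suc u) (s≤s u<n) = init-lookup L u u<n
  where
  init-lookup : ∀ L u → u < length L → (L ++ b ∷ []) ! u ≡ L ! u
  init-lookup (_ ∷ _) zero    _          = refl
  init-lookup (_ ∷ L) (suc u) (s≤s u<n) = init-lookup L u u<n

cycDist-rotIndex : ∀ m u v → u < suc m → v < suc m →
                   cycDist (suc m) (rotIndex m u) (rotIndex m v) ≡ cycDist (suc m) u v
cycDist-rotIndex m zero    zero    _          _          = cycDist-refl (suc m) m
cycDist-rotIndex m zero    (suc y) _          (s≤s y<m) = cycDist-wrap m y (<⇒≤ y<m)
cycDist-rotIndex m (suc x) zero    (s≤s x<m) _          =
  trans (cycDist-comm (suc m) x m) (trans (cycDist-wrap m x (<⇒≤ x<m)) (cycDist-comm (suc m) 0 (suc x)))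
cycDist-rotIndex m (suc x) (suc y) _          _          = refl

module _ (ℓ : ℕ) where

  Dominated : (ℕ → ℕ → ℕ) → ℕ → List Bool → Set
  Dominated δ n L = ∀ v → v < n → ∃[ u ] T (L ! u) × δ u v ≤ ℓ

  module _ {n} (G : Graph n) (δ : ℕ → ℕ → ℕ) (δ-refl : ∀ x → δ x x ≡ 0)
           (adj⇔ : ∀ u v → Adj G u v ⇔ (u ≢ v × δ (toℕ u) (toℕ v) ≤ ℓ)) where

    dominating⇔dominated : ∀ D → Dominating G D ⇔ Dominated δ n (toList D)
    dominating⇔dominated D = mk⇔ to′ from′
      where
      to′ : Dominating G D → Dominated δ n (toList D)
      to′ dom v v<n with dom (fromℕ< v<n)
      ... | inj₁ v∈D =
        v , subst (T ∘ (toList D !_)) (toℕ-fromℕ< v<n) (to ∈⇔! v∈D) , subst (_≤ ℓ) (sym (δ-refl v)) z≤n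
      ... | inj₂ (u , u∈D , adj) =
        toℕ u , to ∈⇔! u∈D , subst (λ z → δ (toℕ u) z ≤ ℓ) (toℕ-fromℕ< v<n) (proj₂ (to (adj⇔ u _) adj))
      from′ : Dominated δ n (toList D) → Dominating G D
      from′ cov v with cov (toℕ v) (toℕ<n v)
      ... | u , m , d with !⇒∈ D m
      ...   | i , refl , i∈D with i Fin.≟ v
      ...     | yes refl = inj₁ i∈D
      ...     | no  i≢v  = inj₂ (i , i∈D , from (adj⇔ i v) (i≢v , d))

  -- The budget automaton

  -- t is the number of non-members that may still be read before a member is due (2ℓ right after a
  -- member); the list is accepted if it ends with at least e of that budget left.
  accepts : (e t : ℕ) → List Bool → Bool
  accepts e t       []          = e ≤ᵇ t
  accepts e t       (true ∷ L)  = accepts e (ℓ + ℓ) L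
  accepts e zero    (false ∷ L) = false
  accepts e (suc t) (false ∷ L) = accepts e t L

  Covered : ℕ → List Bool → ℕ → Set
  Covered p L v = ∃[ u ] T (L ! u) × ∣ p + u - v ∣ ≤ ℓ

  -- Place p non-members and then L at positions 0, 1, …, with two extra members at positions −1
  -- and p + length L + c: every placed position is within ℓ of a member.
  Flanked : ℕ → ℕ → List Bool → Set
  Flanked p c L = ∀ v → v < p + length L → v < ℓ ⊎ Covered p L v ⊎ p + length L + c ≤ v + ℓ

  covered-false : ∀ p L v → Covered p (false ∷ L) v ⇔ Covered (suc p) L v
  covered-false p L v = mk⇔
    (λ { (zero , () , _) ; (suc u , m , d) → u , m , subst (λ z → ∣ z - v ∣ ≤ ℓ) (+-suc p u) d })
    (λ { (u , m , d) → suc u , m , subst (λ z → ∣ z - v ∣ ≤ ℓ) (sym (+-suc p u)) d })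

  flanked-false : ∀ {p c} L → Flanked p c (false ∷ L) ⇔ Flanked (suc p) c L
  flanked-false {p} {c} L = mk⇔
    (λ f v v< → Sum.map₂ (Sum.map (to (covered-false p L v)) (subst (_≤ v + ℓ) (cong (_+ c) len)))
                         (f v (subst (v <_) (sym len) v<)))
    (λ f v v< → Sum.map₂ (Sum.map (from (covered-false p L v)) (subst (_≤ v + ℓ) (cong (_+ c) (sym len))))
                         (f v (subst (v <_) len v<)))
    where
    len : p + suc (length L) ≡ suc p + length L
    len = +-suc p (length L)

  flanked-true : ∀ {p c} L → p ≤ ℓ + ℓ → Flanked p c (true ∷ L) ⇔ Flanked 0 c L
  flanked-true {p} {c} L p≤2ℓ = mk⇔ to′ from′
    where
    n : ℕ
    n = length L
    shift : ∀ u i → ∣ p + u - p + i ∣ ≡ ∣ u - i ∣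
    shift = ∣m+n-m+o∣≡∣n-o∣ p
    reassoc : ∀ x y → p + suc x + y ≡ p + suc (x + y)
    reassoc x y = +-assoc p (suc x) y
    to′ : Flanked p c (true ∷ L) → Flanked 0 c L
    to′ f i i<n with f (p + suc i) (+-monoʳ-< p (s≤s i<n))
    ... | inj₁ lt                     = inj₁ (≤-trans (m≤n+m (suc i) p) (<⇒≤ lt))
    ... | inj₂ (inj₁ (zero , _ , d))  = inj₁ (subst (_≤ ℓ) (shift 0 (suc i)) d)
    ... | inj₂ (inj₁ (suc u , m , d)) = inj₂ (inj₁ (u , m , subst (_≤ ℓ) (shift (suc u) (suc i)) d))
    ... | inj₂ (inj₂ e)               =
      inj₂ (inj₂ (s≤s⁻¹ (+-cancelˡ-≤ p _ _ (subst₂ _≤_ (reassoc n c) (reassoc i ℓ) e))))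
    byHead : ∀ {v} → v ≤ p → v < ℓ ⊎ Covered p (true ∷ L) v ⊎ p + suc n + c ≤ v + ℓ
    byHead {v} v≤p with v <? ℓ
    ... | yes v<ℓ = inj₁ v<ℓ
    ... | no  v≮ℓ = inj₂ (inj₁ (0 , _ , subst (_≤ ℓ) (sym dist) (m≤n+o⇒m∸n≤o p v p≤v+ℓ)))
      where
      dist : ∣ p + 0 - v ∣ ≡ p ∸ v
      dist = trans (cong (λ z → ∣ z - v ∣) (+-identityʳ p)) (m≤n⇒∣n-m∣≡n∸m v≤p)
      p≤v+ℓ : p ≤ v + ℓ
      p≤v+ℓ = ≤-trans p≤2ℓ (+-monoˡ-≤ ℓ (≮⇒≥ v≮ℓ))
    from′ : Flanked 0 c L → Flanked p c (true ∷ L)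
    from′ g v v< with offsetView p v
    ... | inj₁ v<p             = byHead (<⇒≤ v<p)
    ... | inj₂ (zero , refl)   = byHead (≤-reflexive (+-identityʳ p))
    ... | inj₂ (suc i , refl) with g i (s≤s⁻¹ (+-cancelˡ-< p _ _ v<))
    ...   | inj₁ i<ℓ                = inj₂ (inj₁ (0 , _ , subst (_≤ ℓ) (sym (shift 0 (suc i))) i<ℓ))
    ...   | inj₂ (inj₁ (u , m , d)) = inj₂ (inj₁ (suc u , m , subst (_≤ ℓ) (sym (shift (suc u) (suc i))) d))
    ...   | inj₂ (inj₂ e)           =
      inj₂ (inj₂ (subst₂ _≤_ (sym (reassoc n c)) (sym (reassoc i ℓ)) (+-monoʳ-≤ p (s≤s e))))

  flanked-nil : ∀ {p c} → c ≤ ℓ → Flanked p c [] ⇔ p + c ≤ ℓ + ℓ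
  flanked-nil {p} {c} c≤ℓ = mk⇔ to′ from′
    where
    p+0 : p + 0 ≡ p
    p+0 = +-identityʳ p
    to′ : Flanked p c [] → p + c ≤ ℓ + ℓ
    to′ f with p ≤? ℓ
    ... | yes p≤ℓ = +-mono-≤ p≤ℓ c≤ℓ
    ... | no  p≰ℓ with f ℓ (subst (ℓ <_) (sym p+0) (≰⇒> p≰ℓ))
    ...   | inj₁ ℓ<ℓ                 = ⊥-elim (<-irrefl refl ℓ<ℓ)
    ...   | inj₂ (inj₁ (_ , () , _))
    ...   | inj₂ (inj₂ e)            = subst (λ z → z + c ≤ ℓ + ℓ) p+0 e
    from′ : p + c ≤ ℓ + ℓ → Flanked p c []
    from′ le v _ with v <? ℓ
    ... | yes v<ℓ = inj₁ v<ℓ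
    ... | no  v≮ℓ = inj₂ (inj₂ (subst (λ z → z + c ≤ v + ℓ) (sym p+0) (≤-trans le (+-monoˡ-≤ ℓ (≮⇒≥ v≮ℓ)))))

  flanked-overflow : ∀ {p c} L → ℓ + ℓ < p → ¬ Flanked p c L
  flanked-overflow {p} {c} L 2ℓ<p f with f ℓ (≤-trans (≤-trans (s≤s (m≤m+n ℓ ℓ)) 2ℓ<p) (m≤m+n p (length L)))
  ... | inj₁ ℓ<ℓ                = <-irrefl refl ℓ<ℓ
  ... | inj₂ (inj₁ (u , _ , d)) = <⇒≱ 2ℓ<p (≤-trans (m≤m+n p u) (≤-trans (m≤n+∣m-n∣ (p + u) ℓ) (+-monoʳ-≤ ℓ d)))
  ... | inj₂ (inj₂ e)           = <⇒≱ 2ℓ<p (≤-trans (m≤m+n p _) (≤-trans (m≤m+n _ c) e))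

  accepts⇔flanked : ∀ {c} → c ≤ ℓ → ∀ L p t → p + t ≡ ℓ + ℓ → T (accepts c t L) ⇔ Flanked p c L
  accepts⇔flanked {c} c≤ℓ [] p t p+t≡2ℓ = ⇔.trans reserve (⇔.sym (flanked-nil c≤ℓ))
    where
    reserve : T (c ≤ᵇ t) ⇔ p + c ≤ ℓ + ℓ
    reserve = mk⇔ (λ c≤t → subst (p + c ≤_) p+t≡2ℓ (+-monoʳ-≤ p (≤ᵇ⇒≤ c t c≤t)))
                  (λ le → ≤⇒≤ᵇ (+-cancelˡ-≤ p c t (subst (p + c ≤_) (sym p+t≡2ℓ) le)))
  accepts⇔flanked c≤ℓ (true ∷ L) p t p+t≡2ℓ =
    ⇔.trans (accepts⇔flanked c≤ℓ L 0 (ℓ + ℓ) refl) (⇔.sym (flanked-true L (subst (p ≤_) p+t≡2ℓ (m≤m+n p t))))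
  accepts⇔flanked c≤ℓ (false ∷ L) p (suc t) p+t≡2ℓ =
    ⇔.trans (accepts⇔flanked c≤ℓ L (suc p) t (trans (sym (+-suc p t)) p+t≡2ℓ)) (⇔.sym (flanked-false L))
  accepts⇔flanked c≤ℓ (false ∷ L) p zero p+0≡2ℓ =
    mk⇔ (λ ()) (flanked-overflow L 2ℓ<1+p ∘ to (flanked-false L))
    where
    2ℓ<1+p : ℓ + ℓ < suc p
    2ℓ<1+p = s≤s (≤-reflexive (trans (sym p+0≡2ℓ) (+-identityʳ p)))

  pathDominated⇔flanked : ∀ {n} L → length L ≡ n → Dominated (λ u v → ∣ u - v ∣) n L ⇔ Flanked ℓ ℓ L
  pathDominated⇔flanked L refl = mk⇔ to′ from′
    where
    to′ : Dominated (λ u v → ∣ u - v ∣) (length L) L → Flanked ℓ ℓ L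
    to′ cov v v< with offsetView ℓ v
    ... | inj₁ v<ℓ        = inj₁ v<ℓ
    ... | inj₂ (i , refl) with cov i (+-cancelˡ-< ℓ i _ v<)
    ...   | u , m , d = inj₂ (inj₁ (u , m , subst (_≤ ℓ) (sym (∣m+n-m+o∣≡∣n-o∣ ℓ u i)) d))
    from′ : Flanked ℓ ℓ L → Dominated (λ u v → ∣ u - v ∣) (length L) L
    from′ f i i<n with f (ℓ + i) (+-monoʳ-< ℓ i<n)
    ... | inj₁ ℓ+i<ℓ              = ⊥-elim (<⇒≱ ℓ+i<ℓ (m≤m+n ℓ i))
    ... | inj₂ (inj₁ (u , m , d)) = u , m , subst (_≤ ℓ) (∣m+n-m+o∣≡∣n-o∣ ℓ u i) d
    ... | inj₂ (inj₂ e)           =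
      ⊥-elim (<⇒≱ i<n (+-cancelˡ-≤ ℓ _ _ (+-cancelʳ-≤ ℓ (ℓ + length L) (ℓ + i) e)))

  pathPow-dominating⇔accepts : ∀ {n} (D : Subset n) → Dominating (PathPow ℓ n) D ⇔ T (accepts ℓ ℓ (toList D))
  pathPow-dominating⇔accepts {n} D =
    ⇔.trans (dominating⇔dominated (PathPow ℓ n) (λ u v → ∣ u - v ∣) ∣n-n∣≡0 (λ _ _ → ⇔.refl) D)
   (⇔.trans (pathDominated⇔flanked (toList D) (length-toList D))
            (⇔.sym (accepts⇔flanked ≤-refl (toList D) ℓ ℓ refl)))

  -- Cycle powers

  CycDominated : ℕ → List Bool → Set
  CycDominated n = Dominated (cycDist n) n

  cycDominated-rotate : ∀ b L →
    CycDominated (suc (length L)) (b ∷ L) ⇔ CycDominated (suc (length L)) (L ++ b ∷ [])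
  cycDominated-rotate b L = mk⇔ to′ from′
    where
    m : ℕ
    m = length L
    len : length (L ++ b ∷ []) ≡ suc m
    len = trans (length-++-sucʳ L b []) (cong (suc ∘ length) (++-identityʳ L))
    to′ : CycDominated (suc m) (b ∷ L) → CycDominated (suc m) (L ++ b ∷ [])
    to′ cov _ v′< with rotIndex-onto m _ v′<
    ... | v , v< , refl with cov v v<
    ...   | u , mem , d = rotIndex m u , subst T (sym (rotIndex-lookup b L u u<)) mem
                                       , subst (_≤ ℓ) (sym (cycDist-rotIndex m u v u< v<)) d
      where
      u< : u < suc m
      u< = !-bound (b ∷ L) mem
    from′ : CycDominated (suc m) (L ++ b ∷ []) → CycDominated (suc m) (b ∷ L)
    from′ cov v v< with cov (rotIndex m v) (rotIndex-< m v v<)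
    ... | _ , mem , d with rotIndex-onto m _ (subst (_ <_) len (!-bound (L ++ b ∷ []) mem))
    ...   | u , u< , refl = u , subst T (rotIndex-lookup b L u u<) mem
                              , subst (_≤ ℓ) (cycDist-rotIndex m u v u< v<) d

  wrapAround : ∀ {m u v} → u < m → v < m → suc m ∸ ∣ u - v ∣ ≤ ℓ → v < ℓ ⊎ m ≤ v + ℓ
  wrapAround {m} {u} {v} u<m v<m far with ≤-total u v
  ... | inj₁ u≤v = inj₂ (≤-trans (n≤1+n m) (≤-trans 1+m≤ (+-monoˡ-≤ ℓ ∣u-v∣≤v)))
    where
    ∣u-v∣≤v : ∣ u - v ∣ ≤ v
    ∣u-v∣≤v = ≤-trans (≤-reflexive (m≤n⇒∣m-n∣≡n∸m u≤v)) (m∸n≤m v u)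
    1+m≤ : suc m ≤ ∣ u - v ∣ + ℓ
    1+m≤ = ≤-trans (m≤n+m∸n (suc m) ∣ u - v ∣) (+-monoʳ-≤ ∣ u - v ∣ far)
  ... | inj₂ v≤u = inj₁ (+-cancelˡ-< (u ∸ v) v ℓ (subst₂ _<_ (sym (m∸n+n≡m v≤u)) ∣u-v∣+ℓ u<))
    where
    ∣u-v∣+ℓ : ∣ u - v ∣ + ℓ ≡ u ∸ v + ℓ
    ∣u-v∣+ℓ = cong (_+ ℓ) (m≤n⇒∣n-m∣≡n∸m v≤u)
    u< : u < ∣ u - v ∣ + ℓ
    u< = ≤-trans (≤-trans u<m (n≤1+n m)) (≤-trans (m≤n+m∸n (suc m) ∣ u - v ∣) (+-monoʳ-≤ ∣ u - v ∣ far))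

  -- The leading member stands for both extra members of Flanked: at −1, and around the cycle at length R.
  cycDominated-head : ∀ R → CycDominated (suc (length R)) (true ∷ R) ⇔ Flanked 0 0 R
  cycDominated-head R = mk⇔ to′ from′
    where
    m : ℕ
    m = length R
    m+0 : m + 0 ≡ m
    m+0 = +-identityʳ m
    to′ : CycDominated (suc m) (true ∷ R) → Flanked 0 0 R
    to′ cov v v<m with cov (suc v) (s≤s v<m)
    ... | zero , _ , d with ⊓≤-split d
    ...   | inj₁ v<ℓ = inj₁ v<ℓ
    ...   | inj₂ le  = inj₂ (inj₂ (subst (_≤ v + ℓ) (sym m+0) (≤-trans (m≤n+m∸n m v) (+-monoʳ-≤ v le))))
    to′ cov v v<m | suc u , mem , d with ⊓≤-split d
    ...   | inj₁ near = inj₂ (inj₁ (u , mem , near))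
    ...   | inj₂ far  = Sum.map₂ (inj₂ ∘ subst (_≤ v + ℓ) (sym m+0)) (wrapAround (!-bound R mem) v<m far)
    from′ : Flanked 0 0 R → CycDominated (suc m) (true ∷ R)
    from′ f zero    _          = 0 , _ , z≤n
    from′ f (suc v) (s≤s v<m) with f v v<m
    ... | inj₁ v<ℓ                  = 0 , _ , m≤n⇒m⊓o≤n (m ∸ v) v<ℓ
    ... | inj₂ (inj₁ (u , mem , d)) = suc u , mem , m≤n⇒m⊓o≤n _ d
    ... | inj₂ (inj₂ e)             = 0 , _ , m≤n⇒o⊓m≤n (suc v) (m≤n+o⇒m∸n≤o m v (subst (_≤ v + ℓ) m+0 e))

  -- a is the number of non-members read so far; once rotated to the end they shorten the final gap.
  cycAccepts : ℕ → List Bool → Bool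
  cycAccepts a []          = a ≡ᵇ 0
  cycAccepts a (false ∷ L) = cycAccepts (suc a) L
  cycAccepts a (true ∷ L)  = accepts a (ℓ + ℓ) L

  accepts-replicate : ∀ a t → accepts 0 t (replicate a false) ≡ (a ≤ᵇ t)
  accepts-replicate zero    t       = refl
  accepts-replicate (suc a) zero    = refl
  accepts-replicate (suc a) (suc t) = trans (accepts-replicate a t) (sym (≤ᵇ-suc a t))

  accepts-reserve : ∀ a t L → accepts 0 t (L ++ replicate a false) ≡ accepts a t L
  accepts-reserve a t       []          = accepts-replicate a t
  accepts-reserve a t       (true ∷ L)  = accepts-reserve a (ℓ + ℓ) L
  accepts-reserve a zero    (false ∷ L) = refl
  accepts-reserve a (suc t) (false ∷ L) = accepts-reserve a t L

  cycAccepts⇔ : ∀ L a → T (cycAccepts a L) ⇔ CycDominated (length L + a) (L ++ replicate a false)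
  cycAccepts⇔ []          zero    = mk⇔ (λ _ _ ()) _
  cycAccepts⇔ []          (suc a) = mk⇔ (λ ()) undominated
    where
    undominated : CycDominated (suc a) (replicate (suc a) false) → T false
    undominated cov with cov 0 (s≤s z≤n)
    ... | u , m , _ = replicate-false-! (suc a) u m
  cycAccepts⇔ (false ∷ L) a       =
    ⇔.trans (cycAccepts⇔ L (suc a))
   (⇔.trans (≡⇒⇔ (cong₂ CycDominated (trans (+-suc (length L) a) (cong suc (sym len))) moveLast))
   (⇔.trans (⇔.sym (cycDominated-rotate false L′))
            (≡⇒⇔ (cong (λ n → CycDominated (suc n) (false ∷ L′)) len))))
    where
    L′ : List Bool
    L′ = L ++ replicate a false
    len : length L′ ≡ length L + a
    len = trans (length-++ L) (cong (length L +_) (length-replicate a))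
    moveLast : L ++ replicate (suc a) false ≡ L′ ++ false ∷ []
    moveLast = trans (cong (L ++_) (sym (replicate-∷ʳ a false))) (sym (++-assoc L (replicate a false) _))
  cycAccepts⇔ (true ∷ R)  a       =
    ⇔.trans (≡⇒⇔ (cong T (sym (accepts-reserve a (ℓ + ℓ) R))))
   (⇔.trans (accepts⇔flanked z≤n R′ 0 (ℓ + ℓ) refl)
   (⇔.trans (⇔.sym (cycDominated-head R′))
            (≡⇒⇔ (cong (λ n → CycDominated (suc n) (true ∷ R′)) len))))
    where
    R′ : List Bool
    R′ = R ++ replicate a false
    len : length R′ ≡ length R + a
    len = trans (length-++ R) (cong (length R +_) (length-replicate a))

  cyclePow-dominating⇔accepts : ∀ {n} (D : Subset n) → Dominating (CyclePow ℓ n) D ⇔ T (cycAccepts 0 (toList D))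
  cyclePow-dominating⇔accepts {n} D =
    ⇔.trans (dominating⇔dominated (CyclePow ℓ n) (cycDist n) (cycDist-refl n) (λ _ _ → ⇔.refl) D)
            (⇔.sym (⇔.trans (cycAccepts⇔ (toList D) 0)
                            (≡⇒⇔ (cong₂ CycDominated size (++-identityʳ (toList D))))))
    where
    size : length (toList D) + 0 ≡ n
    size = trans (+-identityʳ _) (length-toList D)

  accepted? : ∀ e t {n} → Decidable (λ (D : Subset n) → T (accepts e t (toList D)))
  accepted? e t D = T? (accepts e t (toList D))

  acceptCount : (e t n : ℕ) → ℕ → ℕ
  acceptCount e t n = #subsets (accepted? e t {n})

  -- memberFirst e n counts the accepted lists of length n (reserve e) that begin with a member;
  -- firstMemberWithin e s n those whose first member is at a position a < s, with reserve e a.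
  memberFirst : ℕ → ℕ → ℕ → ℕ
  memberFirst e zero    _ = 0
  memberFirst e (suc n) k = xTimes (acceptCount e (ℓ + ℓ) n) k

  firstMemberWithin : (ℕ → ℕ) → ℕ → ℕ → ℕ → ℕ
  firstMemberWithin e s n k = ∑[ a < s ] memberFirst (e (toℕ a)) (n ∸ toℕ a) k

  acceptCount-suc : ∀ e t n k → acceptCount e (suc t) (suc n) k ≡ acceptCount e t n k + memberFirst e (suc n) k
  acceptCount-suc e t n k = #subsets-suc (accepted? e (suc t) {suc n}) k

  acceptCount-exhausted : ∀ e n k → acceptCount e 0 (suc n) k ≡ memberFirst e (suc n) k
  acceptCount-exhausted e n k = trans (#subsets-suc (accepted? e 0 {suc n}) k)
    (cong (_+ memberFirst e (suc n) k) (#subsets-none (accepted? e 0 {suc n} ∘ (false ∷ᵥ_)) (λ _ ()) k))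

  acceptCount-nil-cong : ∀ {e t e′ t′} → (e ≤ t ⇔ e′ ≤ t′) → ∀ k → acceptCount e t 0 k ≡ acceptCount e′ t′ 0 k
  acceptCount-nil-cong {e} {t} {e′} {t′} e≤t⇔e′≤t′ = #subsets-cong (accepted? e t {0}) (accepted? e′ t′)
    ( (λ { {[]ᵥ} q → ≤⇒≤ᵇ (to e≤t⇔e′≤t′ (≤ᵇ⇒≤ e t q)) })
    , (λ { {[]ᵥ} q → ≤⇒≤ᵇ (from e≤t⇔e′≤t′ (≤ᵇ⇒≤ e′ t′ q)) }) )

  acceptCount-nil-zero : ∀ {e t} → t < e → ∀ k → acceptCount e t 0 k ≡ 0
  acceptCount-nil-zero {e} {t} t<e = #subsets-none (accepted? e t {0}) λ { []ᵥ q → <⇒≱ t<e (≤ᵇ⇒≤ e t q) }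

  accepts⇒reserve≤ : ∀ {e} L t → t ≤ ℓ + ℓ → T (accepts e t L) → e ≤ ℓ + ℓ
  accepts⇒reserve≤ {e} []          t       t≤2ℓ q = ≤-trans (≤ᵇ⇒≤ e t q) t≤2ℓ
  accepts⇒reserve≤     (true ∷ L)  t       _    q = accepts⇒reserve≤ L (ℓ + ℓ) ≤-refl q
  accepts⇒reserve≤     (false ∷ L) (suc t) t≤2ℓ q = accepts⇒reserve≤ L t (≤-trans (n≤1+n t) t≤2ℓ) q

  memberFirst-0 : ∀ e n → memberFirst e n 0 ≡ 0
  memberFirst-0 e zero    = refl
  memberFirst-0 e (suc n) = refl

  memberFirst-excess : ∀ {e} → ℓ + ℓ < e → ∀ n k → memberFirst e n k ≡ 0
  memberFirst-excess     _    zero    k       = refl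
  memberFirst-excess     _    (suc n) zero    = refl
  memberFirst-excess {e} 2ℓ<e (suc n) (suc k) =
    #subsets-none (accepted? e (ℓ + ℓ) {n}) (λ D q → <⇒≱ 2ℓ<e (accepts⇒reserve≤ (toList D) (ℓ + ℓ) ≤-refl q)) k

  firstMemberWithin-0 : ∀ e s n → firstMemberWithin e s n 0 ≡ 0
  firstMemberWithin-0 e s n = ∑-zero s _ (λ a → memberFirst-0 (e (toℕ a)) (n ∸ toℕ a))

  firstMemberWithin-empty : ∀ e s k → firstMemberWithin e s 0 k ≡ 0
  firstMemberWithin-empty e s k = ∑-zero s _ (λ a → cong (λ z → memberFirst (e (toℕ a)) z k) (0∸n≡0 (toℕ a)))

  -- The first summand counts the list without members: reading n non-members with reserve e is
  -- reading none with reserve n + e.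
  acceptCount-firstMember : ∀ e t n k →
    acceptCount e t n k ≡ acceptCount (n + e) t 0 k + firstMemberWithin (λ _ → e) (suc t) n k
  acceptCount-firstMember e t zero k =
    sym (trans (cong (acceptCount e t 0 k +_) (firstMemberWithin-empty (λ _ → e) (suc t) k)) (+-identityʳ _))
  acceptCount-firstMember e zero (suc n) k = begin
    acceptCount e 0 (suc n) k     ≡⟨ acceptCount-exhausted e n k ⟩
    memberFirst e (suc n) k       ≡⟨ +-identityʳ _ ⟨
    memberFirst e (suc n) k + 0   ≡⟨ cong (_+ (memberFirst e (suc n) k + 0)) noMembers ⟨
    acceptCount (suc n + e) 0 0 k + (memberFirst e (suc n) k + 0) ∎
    where
    open ≡-Reasoning
    noMembers : acceptCount (suc n + e) 0 0 k ≡ 0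
    noMembers = acceptCount-nil-zero (s≤s z≤n) k
  acceptCount-firstMember e (suc t) (suc n) k = begin
    acceptCount e (suc t) (suc n) k
      ≡⟨ acceptCount-suc e t n k ⟩
    acceptCount e t n k + memberFirst e (suc n) k
      ≡⟨ cong (_+ memberFirst e (suc n) k) (acceptCount-firstMember e t n k) ⟩
    acceptCount (n + e) t 0 k + rest + memberFirst e (suc n) k
      ≡⟨ +-assoc (acceptCount (n + e) t 0 k) rest _ ⟩
    acceptCount (n + e) t 0 k + (rest + memberFirst e (suc n) k)
      ≡⟨ cong₂ _+_ (acceptCount-nil-cong (mk⇔ s≤s s≤s⁻¹) k) (+-comm rest _) ⟩
    acceptCount (suc n + e) (suc t) 0 k + (memberFirst e (suc n) k + rest) ∎
    where
    open ≡-Reasoning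
    rest : ℕ
    rest = firstMemberWithin (λ _ → e) (suc t) n k

  firstMemberWithin-suc : ∀ e s m k → s ≤ suc m →
    firstMemberWithin e s (suc m) (suc k)
      ≡ ∑[ a < s ] acceptCount (m ∸ toℕ a + e (toℕ a)) (ℓ + ℓ) 0 k
        + ∑[ j < suc (ℓ + ℓ) ] firstMemberWithin e s (m ∸ toℕ j) k
  firstMemberWithin-suc e s m k s≤1+m = begin
    ∑[ a < s ] memberFirst (e (toℕ a)) (suc m ∸ toℕ a) (suc k)
      ≡⟨ ∑-cong {s} (λ a → cong (λ z → memberFirst (e (toℕ a)) z (suc k)) (+-∸-assoc 1 (a≤m a))) ⟩
    ∑[ a < s ] acceptCount (e (toℕ a)) (ℓ + ℓ) (m ∸ toℕ a) k
      ≡⟨ ∑-cong {s} (λ a → acceptCount-firstMember (e (toℕ a)) (ℓ + ℓ) (m ∸ toℕ a) k) ⟩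
    ∑[ a < s ] (boundary a + ∑[ j < suc (ℓ + ℓ) ] later a j)
      ≡⟨ ∑-distrib-+ {s} boundary _ ⟩
    ∑[ a < s ] boundary a + ∑[ a < s ] ∑[ j < suc (ℓ + ℓ) ] later a j
      ≡⟨ cong (∑[ a < s ] boundary a +_) (∑-comm {s} {suc (ℓ + ℓ)} later) ⟩
    ∑[ a < s ] boundary a + ∑[ j < suc (ℓ + ℓ) ] ∑[ a < s ] later a j
      ≡⟨ cong (∑[ a < s ] boundary a +_) (∑-cong {suc (ℓ + ℓ)} λ j → ∑-cong {s} λ a →
           cong (λ z → memberFirst (e (toℕ a)) z k) (∸-comm m (toℕ a) (toℕ j))) ⟩
    ∑[ a < s ] boundary a + ∑[ j < suc (ℓ + ℓ) ] firstMemberWithin e s (m ∸ toℕ j) k ∎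
    where
    open ≡-Reasoning
    a≤m : ∀ (a : Fin s) → toℕ a ≤ m
    a≤m a = s≤s⁻¹ (≤-trans (toℕ<n a) s≤1+m)
    boundary : Fin s → ℕ
    boundary a = acceptCount (m ∸ toℕ a + e (toℕ a)) (ℓ + ℓ) 0 k
    later : Fin s → Fin (suc (ℓ + ℓ)) → ℕ
    later a j = memberFirst (e (toℕ a)) (m ∸ toℕ a ∸ toℕ j) k

  -- The recurrences

  -- Only the last summands can be nonzero; both are 1 iff k = 0 and m = 2ℓ, accounting for the
  -- one-element dominating set {ℓ} of the path on 2ℓ + 1 vertices.
  acceptCount-boundary : ∀ m → ℓ + ℓ ≤ m → ∀ k →
      ∑[ a < suc ℓ ] acceptCount (m ∸ toℕ a + ℓ) (ℓ + ℓ) 0 k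
    ≡ ∑[ j < suc (ℓ + ℓ) ] acceptCount (m ∸ toℕ j + ℓ) ℓ 0 k
  acceptCount-boundary m 2ℓ≤m k = begin
    ∑[ a < suc ℓ ] acceptCount (m ∸ toℕ a + ℓ) (ℓ + ℓ) 0 k
      ≡⟨ ∑-only-last ℓ (λ a → acceptCount (m ∸ a + ℓ) (ℓ + ℓ) 0 k) (λ a → acceptCount-nil-zero′ ∘ 2ℓ<m∸a+ℓ) ⟩
    acceptCount (m ∸ ℓ + ℓ) (ℓ + ℓ) 0 k
      ≡⟨ acceptCount-nil-cong (⇔.trans (≡⇒⇔ (cong (_≤ ℓ + ℓ) (m∸n+n≡m ℓ≤m))) m≤2ℓ⇔) k ⟩
    acceptCount (m ∸ (ℓ + ℓ) + ℓ) ℓ 0 k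
      ≡⟨ ∑-only-last (ℓ + ℓ) (λ j → acceptCount (m ∸ j + ℓ) ℓ 0 k) (λ j → acceptCount-nil-zero′ ∘ ℓ<m∸j+ℓ) ⟨
    ∑[ j < suc (ℓ + ℓ) ] acceptCount (m ∸ toℕ j + ℓ) ℓ 0 k ∎
    where
    open ≡-Reasoning
    acceptCount-nil-zero′ : ∀ {e t} → t < e → acceptCount e t 0 k ≡ 0
    acceptCount-nil-zero′ t<e = acceptCount-nil-zero t<e k
    ℓ≤m : ℓ ≤ m
    ℓ≤m = ≤-trans (m≤m+n ℓ ℓ) 2ℓ≤m
    2ℓ<m∸a+ℓ : ∀ {a} → a < ℓ → ℓ + ℓ < m ∸ a + ℓ
    2ℓ<m∸a+ℓ {a} a<ℓ = +-monoˡ-< ℓ (m+n≤o⇒m≤o∸n (suc ℓ) (≤-trans (≤-reflexive (sym (+-suc ℓ a)))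
                                                                 (≤-trans (+-monoʳ-≤ ℓ a<ℓ) 2ℓ≤m)))
    ℓ<m∸j+ℓ : ∀ {j} → j < ℓ + ℓ → ℓ < m ∸ j + ℓ
    ℓ<m∸j+ℓ j<2ℓ = +-monoˡ-< ℓ (m<n⇒0<n∸m (<-≤-trans j<2ℓ 2ℓ≤m))
    m≤2ℓ⇔ : m ≤ ℓ + ℓ ⇔ m ∸ (ℓ + ℓ) + ℓ ≤ ℓ
    m≤2ℓ⇔ = mk⇔ (λ m≤2ℓ → ≤-reflexive (cong (_+ ℓ) (m≤n⇒m∸n≡0 m≤2ℓ)))
                (λ le → m∸n≡0⇒m≤n (n≤0⇒n≡0 (+-cancelʳ-≤ ℓ (m ∸ (ℓ + ℓ)) 0 le)))

  acceptCount-recurrence : ∀ m → ℓ + ℓ ≤ m → ∀ k →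
    acceptCount ℓ ℓ (suc m) k ≡ xTimes (λ k → ∑[ j < suc (ℓ + ℓ) ] acceptCount ℓ ℓ (m ∸ toℕ j) k) k
  acceptCount-recurrence m 2ℓ≤m zero = trans (acceptCount-firstMember ℓ ℓ (suc m) 0)
    (cong₂ _+_ (acceptCount-nil-zero (s≤s (m≤n+m ℓ m)) 0) (firstMemberWithin-0 (λ _ → ℓ) (suc ℓ) (suc m)))
  acceptCount-recurrence m 2ℓ≤m (suc k) = begin
    acceptCount ℓ ℓ (suc m) (suc k)
      ≡⟨ acceptCount-firstMember ℓ ℓ (suc m) (suc k) ⟩
    acceptCount (suc m + ℓ) ℓ 0 (suc k) + F (suc m) (suc k)
      ≡⟨ cong (_+ F (suc m) (suc k)) (acceptCount-nil-zero (s≤s (m≤n+m ℓ m)) (suc k)) ⟩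
    F (suc m) (suc k)
      ≡⟨ firstMemberWithin-suc (λ _ → ℓ) (suc ℓ) m k (s≤s (≤-trans (m≤m+n ℓ ℓ) 2ℓ≤m)) ⟩
    ∑[ a < suc ℓ ] acceptCount (m ∸ toℕ a + ℓ) (ℓ + ℓ) 0 k + ∑[ j < suc (ℓ + ℓ) ] F (m ∸ toℕ j) k
      ≡⟨ cong (_+ ∑[ j < suc (ℓ + ℓ) ] F (m ∸ toℕ j) k) (acceptCount-boundary m 2ℓ≤m k) ⟩
    ∑[ j < suc (ℓ + ℓ) ] acceptCount (m ∸ toℕ j + ℓ) ℓ 0 k + ∑[ j < suc (ℓ + ℓ) ] F (m ∸ toℕ j) k
      ≡⟨ ∑-distrib-+ {suc (ℓ + ℓ)} (λ j → acceptCount (m ∸ toℕ j + ℓ) ℓ 0 k) (λ j → F (m ∸ toℕ j) k) ⟨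
    ∑[ j < suc (ℓ + ℓ) ] (acceptCount (m ∸ toℕ j + ℓ) ℓ 0 k + F (m ∸ toℕ j) k)
      ≡⟨ ∑-cong {suc (ℓ + ℓ)} (λ j → acceptCount-firstMember ℓ ℓ (m ∸ toℕ j) k) ⟨
    ∑[ j < suc (ℓ + ℓ) ] acceptCount ℓ ℓ (m ∸ toℕ j) k ∎
    where
    open ≡-Reasoning
    F : ℕ → ℕ → ℕ
    F = firstMemberWithin (λ _ → ℓ) (suc ℓ)

  cycAccepted? : ∀ a {n} → Decidable (λ (D : Subset n) → T (cycAccepts a (toList D)))
  cycAccepted? a D = T? (cycAccepts a (toList D))

  cycCount : (a n : ℕ) → ℕ → ℕ
  cycCount a n = #subsets (cycAccepted? a {n})

  cycCount-firstMember : ∀ a n k → 0 < n → cycCount a n k ≡ firstMemberWithin (a +_) (suc (ℓ + ℓ)) n k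
  cycCount-firstMember a (suc zero) k _ = begin
    cycCount a 1 k
      ≡⟨ #subsets-suc (cycAccepted? a {1}) k ⟩
    cycCount (suc a) 0 k + memberFirst a 1 k
      ≡⟨ cong (_+ memberFirst a 1 k) (#subsets-none (cycAccepted? (suc a) {0}) (λ { []ᵥ () }) k) ⟩
    memberFirst a 1 k
      ≡⟨ +-identityʳ _ ⟨
    memberFirst a 1 k + 0
      ≡⟨ cong₂ _+_ (cong (λ e → memberFirst e 1 k) (+-identityʳ a))
                   (firstMemberWithin-empty (λ i → a + suc i) (ℓ + ℓ) k) ⟨
    firstMemberWithin (a +_) (suc (ℓ + ℓ)) 1 k ∎
    where open ≡-Reasoning
  cycCount-firstMember a (suc (suc n)) k _ = begin
    cycCount a (suc (suc n)) k
      ≡⟨ #subsets-suc (cycAccepted? a {suc (suc n)}) k ⟩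
    cycCount (suc a) (suc n) k + head
      ≡⟨ cong (_+ head) (cycCount-firstMember (suc a) (suc n) k (s≤s z≤n)) ⟩
    ∑[ i < suc (ℓ + ℓ) ] later (toℕ i) + head
      ≡⟨ cong (_+ head) (∑-last (ℓ + ℓ) later) ⟩
    ∑[ i < ℓ + ℓ ] later (toℕ i) + later (ℓ + ℓ) + head
      ≡⟨ cong (λ z → ∑[ i < ℓ + ℓ ] later (toℕ i) + z + head)
              (memberFirst-excess (s≤s (m≤n+m (ℓ + ℓ) a)) (suc n ∸ (ℓ + ℓ)) k) ⟩
    ∑[ i < ℓ + ℓ ] later (toℕ i) + 0 + head
      ≡⟨ trans (cong (_+ head) (+-identityʳ _)) (+-comm (∑[ i < ℓ + ℓ ] later (toℕ i)) head) ⟩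
    head + ∑[ i < ℓ + ℓ ] later (toℕ i)
      ≡⟨ cong₂ _+_ (cong (λ e → memberFirst e (suc (suc n)) k) (+-identityʳ a))
                   (∑-cong {ℓ + ℓ} (λ i → cong (λ e → memberFirst e (suc n ∸ toℕ i) k) (+-suc a (toℕ i)))) ⟨
    firstMemberWithin (a +_) (suc (ℓ + ℓ)) (suc (suc n)) k ∎
    where
    open ≡-Reasoning
    head : ℕ
    head = memberFirst a (suc (suc n)) k
    later : ℕ → ℕ
    later i = memberFirst (suc a + i) (suc n ∸ i) k

  cycCount-recurrence : ∀ m → ℓ + ℓ < m → ∀ k →
    cycCount 0 (suc m) k ≡ xTimes (λ k → ∑[ j < suc (ℓ + ℓ) ] cycCount 0 (m ∸ toℕ j) k) k
  cycCount-recurrence m 2ℓ<m zero =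
    trans (cycCount-firstMember 0 (suc m) 0 (s≤s z≤n)) (firstMemberWithin-0 (0 +_) (suc (ℓ + ℓ)) (suc m))
  cycCount-recurrence m 2ℓ<m (suc k) = begin
    cycCount 0 (suc m) (suc k)
      ≡⟨ cycCount-firstMember 0 (suc m) (suc k) (s≤s z≤n) ⟩
    F (suc m) (suc k)
      ≡⟨ firstMemberWithin-suc (0 +_) (suc (ℓ + ℓ)) m k (s≤s (<⇒≤ 2ℓ<m)) ⟩
    ∑[ a < suc (ℓ + ℓ) ] acceptCount (m ∸ toℕ a + toℕ a) (ℓ + ℓ) 0 k + ∑[ j < suc (ℓ + ℓ) ] F (m ∸ toℕ j) k
      ≡⟨ cong (_+ ∑[ j < suc (ℓ + ℓ) ] F (m ∸ toℕ j) k)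
              (∑-zero (suc (ℓ + ℓ)) _ (λ a → acceptCount-nil-zero (2ℓ<m∸a+a a) k)) ⟩
    ∑[ j < suc (ℓ + ℓ) ] F (m ∸ toℕ j) k
      ≡⟨ ∑-cong {suc (ℓ + ℓ)} (λ j → cycCount-firstMember 0 (m ∸ toℕ j) k (m<n⇒0<n∸m (j<m j))) ⟨
    ∑[ j < suc (ℓ + ℓ) ] cycCount 0 (m ∸ toℕ j) k ∎
    where
    open ≡-Reasoning
    F : ℕ → ℕ → ℕ
    F = firstMemberWithin (0 +_) (suc (ℓ + ℓ))
    j<m : ∀ (j : Fin (suc (ℓ + ℓ))) → toℕ j < m
    j<m j = ≤-trans (toℕ<n j) 2ℓ<m
    2ℓ<m∸a+a : ∀ (a : Fin (suc (ℓ + ℓ))) → ℓ + ℓ < m ∸ toℕ a + toℕ a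
    2ℓ<m∸a+a a = subst (ℓ + ℓ <_) (sym (m∸n+n≡m (<⇒≤ (j<m a)))) 2ℓ<m

  pathPow-domPoly : ∀ n k → domPoly (PathPow ℓ n) k ≡ acceptCount ℓ ℓ n k
  pathPow-domPoly n = #subsets-cong (dominating? (PathPow ℓ n)) (accepted? ℓ ℓ)
    ((λ {D} → to (pathPow-dominating⇔accepts D)) , (λ {D} → from (pathPow-dominating⇔accepts D)))

  cyclePow-domPoly : ∀ n k → domPoly (CyclePow ℓ n) k ≡ cycCount 0 n k
  cyclePow-domPoly n = #subsets-cong (dominating? (CyclePow ℓ n)) (cycAccepted? 0)
    ((λ {D} → to (cyclePow-dominating⇔accepts D)) , (λ {D} → from (cyclePow-dominating⇔accepts D)))

  2ℓ+c≡c+[ℓ+ℓ] : ∀ c → 2 * ℓ + c ≡ c + (ℓ + ℓ)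
  2ℓ+c≡c+[ℓ+ℓ] c = trans (+-comm (2 * ℓ) c) (cong (λ z → c + (ℓ + z)) (+-identityʳ ℓ))

  sumFrom1-window : ∀ (f g : ℕ → ℕ → ℕ) → (∀ n k → f n k ≡ g n k) → ∀ m k →
    sumFrom1 (2 * ℓ + 1) (λ j → f (suc m ∸ j)) k ≡ ∑[ j < suc (ℓ + ℓ) ] g (m ∸ toℕ j) k
  sumFrom1-window f g f≗g m k = begin
    sumFrom1 (2 * ℓ + 1) (λ j → f (suc m ∸ j)) k
      ≡⟨ sumFrom1≡∑ (2 * ℓ + 1) (λ j → f (suc m ∸ j)) k ⟩
    ∑[ j < 2 * ℓ + 1 ] f (m ∸ toℕ j) k
      ≡⟨ cong (λ s → ∑[ j < s ] f (m ∸ toℕ j) k) (2ℓ+c≡c+[ℓ+ℓ] 1) ⟩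
    ∑[ j < suc (ℓ + ℓ) ] f (m ∸ toℕ j) k
      ≡⟨ ∑-cong {suc (ℓ + ℓ)} (λ j → f≗g (m ∸ toℕ j) k) ⟩
    ∑[ j < suc (ℓ + ℓ) ] g (m ∸ toℕ j) k ∎
    where open ≡-Reasoning

  pathPow-recurrence : ∀ n → 2 * ℓ + 1 ≤ n → ∀ k →
    domPoly (PathPow ℓ n) k ≡ xTimes (sumFrom1 (2 * ℓ + 1) (λ j → domPoly (PathPow ℓ (n ∸ j)))) k
  pathPow-recurrence n n≥ k with subst (_≤ n) (2ℓ+c≡c+[ℓ+ℓ] 1) n≥
  ... | s≤s {n = m} 2ℓ≤m = begin
    domPoly (PathPow ℓ (suc m)) k
      ≡⟨ pathPow-domPoly (suc m) k ⟩
    acceptCount ℓ ℓ (suc m) k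
      ≡⟨ acceptCount-recurrence m 2ℓ≤m k ⟩
    xTimes (λ k → ∑[ j < suc (ℓ + ℓ) ] acceptCount ℓ ℓ (m ∸ toℕ j) k) k
      ≡⟨ xTimes-cong (sumFrom1-window _ _ pathPow-domPoly m) k ⟨
    xTimes (sumFrom1 (2 * ℓ + 1) (λ j → domPoly (PathPow ℓ (suc m ∸ j)))) k ∎
    where open ≡-Reasoning

  cyclePow-recurrence : ∀ n → 2 * ℓ + 2 ≤ n → ∀ k →
    domPoly (CyclePow ℓ n) k ≡ xTimes (sumFrom1 (2 * ℓ + 1) (λ j → domPoly (CyclePow ℓ (n ∸ j)))) k
  cyclePow-recurrence n n≥ k with subst (_≤ n) (2ℓ+c≡c+[ℓ+ℓ] 2) n≥
  ... | s≤s {n = m} 2ℓ<m = begin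
    domPoly (CyclePow ℓ (suc m)) k
      ≡⟨ cyclePow-domPoly (suc m) k ⟩
    cycCount 0 (suc m) k
      ≡⟨ cycCount-recurrence m 2ℓ<m k ⟩
    xTimes (λ k → ∑[ j < suc (ℓ + ℓ) ] cycCount 0 (m ∸ toℕ j) k) k
      ≡⟨ xTimes-cong (sumFrom1-window _ _ cyclePow-domPoly m) k ⟨
    xTimes (sumFrom1 (2 * ℓ + 1) (λ j → domPoly (CyclePow ℓ (suc m ∸ j)))) k ∎
    where open ≡-Reasoning

theorem4 : (∀ (ℓ n : ℕ) → 1 ≤ ℓ → 2 * ℓ + 1 ≤ n → ∀ k →
               domPoly (PathPow ℓ n) k
                 ≡ xTimes (sumFrom1 (2 * ℓ + 1) (λ j → domPoly (PathPow ℓ (n ∸ j)))) k)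
           × (∀ (ℓ n : ℕ) → 1 ≤ ℓ → 2 * ℓ + 2 ≤ n → ∀ k →
               domPoly (CyclePow ℓ n) k
                 ≡ xTimes (sumFrom1 (2 * ℓ + 1) (λ j → domPoly (CyclePow ℓ (n ∸ j)))) k)
theorem4 = (λ ℓ n _ → pathPow-recurrence ℓ n) , (λ ℓ n _ → cyclePow-recurrence ℓ n)
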